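{- The atom $x\in y$ is not existentially expressible in $\mathbb{BST}^{+}$: there is no $\mathbb{BST}^{+}$-formula $\Psi(x,y,\vec z)$ (with $\vec z$ a tuple of set variables distinct from $x,y$) such that \[ \models\; x\in y \;\longleftrightarrow\; (\exists \vec z)\,\Psi(x,y,\vec z). \]
   Context: $\mathbb{BST}^{+}$ is the collection of all propositional combinations (using $\wedge,\vee,\to,\leftrightarrow,\neg$) of atoms of the form $x' = y'\setminus z'$, where the variables are set variables ranging over the von Neumann universe $\mathcal{V}$ of well-founded sets and $\setminus$ is ordinary set difference. $\models$ denotes truth under every assignment of sets in $\mathcal{V}$ to the free variables. A formula $\psi(\vec x)$ is existentially expressible in a theory $\mathcal{T}$ if there is a $\mathcal{T}$-formula $\Psi(\vec x,\vec z)$ with $\models \psi(\vec x)\leftrightarrow(\exists\vec z)\Psi(\vec x,\vec z)$. -}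

module Defs where

open import Data.Nat using (ℕ; suc)
open import Data.Fin using (Fin; zero; suc)
open import Data.Product using (Σ; _×_; proj₁)
open import Data.Sum using (_⊎_)
open import Relation.Nullary using (¬_)

-- Aczel's model of (well-founded, iterative) sets: a set is a family of sets
-- indexed by a small type.  Well-foundedness is built into the inductive type.
data 𝕍 : Set₁ where
  sup : (A : Set) → (A → 𝕍) → 𝕍

_≐_ : 𝕍 → 𝕍 → Set
sup A f ≐ sup B g =
  ((a : A) → Σ B (λ b → f a ≐ g b)) × ((b : B) → Σ A (λ a → f a ≐ g b))

_∈_ : 𝕍 → 𝕍 → Set
x ∈ sup A f = Σ A (λ a → x ≐ f a)

_∖_ : 𝕍 → 𝕍 → 𝕍
sup A f ∖ y = sup (Σ A (λ a → ¬ (f a ∈ y))) (λ p → f (proj₁ p))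

-- BST⁺ formulas in n set variables (indexed by Fin n):
-- propositional combinations of atoms  x_i = x_j ∖ x_k .
data Formula (n : ℕ) : Set where
  atom        : Fin n → Fin n → Fin n → Formula n
  neg         : Formula n → Formula n
  and or imp iff : Formula n → Formula n → Formula n

⟦_⟧ : {n : ℕ} → Formula n → (Fin n → 𝕍) → Set
⟦ atom i j k ⟧ ρ = ρ i ≐ (ρ j ∖ ρ k)
⟦ neg φ ⟧ ρ = ¬ (⟦ φ ⟧ ρ)
⟦ and φ ψ ⟧ ρ = ⟦ φ ⟧ ρ × ⟦ ψ ⟧ ρ
⟦ or φ ψ ⟧ ρ = ⟦ φ ⟧ ρ ⊎ ⟦ ψ ⟧ ρ
⟦ imp φ ψ ⟧ ρ = ⟦ φ ⟧ ρ → ⟦ ψ ⟧ ρ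
⟦ iff φ ψ ⟧ ρ = (⟦ φ ⟧ ρ → ⟦ ψ ⟧ ρ) × (⟦ ψ ⟧ ρ → ⟦ φ ⟧ ρ)

env : {m : ℕ} → 𝕍 → 𝕍 → (Fin m → 𝕍) → Fin (suc (suc m)) → 𝕍
env x y z zero = x
env x y z (suc zero) = y
env x y z (suc (suc i)) = z i

module Submission where

open import Defs
open import Data.Nat using (ℕ; suc)
open import Data.Fin using (Fin; zero; suc)
open import Data.Product using (Σ; _×_; _,_; proj₁; proj₂)
open import Data.Product.Function.NonDependent.Propositional using (_×-⇔_)
open import Data.Sum.Function.Propositional using (_⊎-⇔_)
open import Data.Unit using (⊤; tt)
open import Data.Empty using (⊥)
open import Function using (_∘_; _⇔_; mk⇔; Equivalence)
open import Function.Related.TypeIsomorphisms using (→-cong-⇔; ¬-cong-⇔)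
open import Relation.Nullary using (¬_; Dec)
open import Relation.Binary.PropositionalEquality using (_≡_; refl)

-- The map  x ↦ { {u} | u ∈ x }  commutes with ∖ and reflects every atom
-- x = y ∖ z, so no BST⁺ formula can tell a tuple from its image.  It sends
-- ∅ ∈ {∅} to ∅ ∉ {{∅}}, whereas an existential definition of ∈ would be
-- carried along by the map: the witnesses for ∅ ∈ {∅} map to witnesses for
-- the image pair.

singleton : 𝕍 → 𝕍
singleton w = sup ⊤ (λ _ → w)

∅ : 𝕍
∅ = sup ⊥ (λ ())

singletons : 𝕍 → 𝕍
singletons (sup A f) = sup A (singleton ∘ f)

singleton-cong : ∀ {w v} → w ≐ v → singleton w ≐ singleton v
singleton-cong w≐v = (λ _ → tt , w≐v) , (λ _ → tt , w≐v)

singleton-injective : ∀ {w v} → singleton w ≐ singleton v → w ≐ v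
singleton-injective eq = proj₂ (proj₁ eq tt)

singleton∈singletons⇔∈ : ∀ w c → (singleton w ∈ singletons c) ⇔ (w ∈ c)
singleton∈singletons⇔∈ w (sup C g) =
  mk⇔ (λ (γ , e) → γ , singleton-injective e) (λ (γ , e) → γ , singleton-cong e)

singletons-∖ : ∀ a b c → (a ≐ (b ∖ c)) ⇔ (singletons a ≐ (singletons b ∖ singletons c))
singletons-∖ (sup A g) (sup B f) c = mk⇔ to from
  where
    ∈-from-image : ∀ {w} → singleton w ∈ singletons c → w ∈ c
    ∈-from-image = Equivalence.to (singleton∈singletons⇔∈ _ c)

    ∈-to-image : ∀ {w} → w ∈ c → singleton w ∈ singletons c
    ∈-to-image = Equivalence.from (singleton∈singletons⇔∈ _ c)

    to : sup A g ≐ (sup B f ∖ c) → singletons (sup A g) ≐ (singletons (sup B f) ∖ singletons c)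
    to (l , r) =
        (λ α → let ((β , β∉c) , e) = l α in (β , β∉c ∘ ∈-from-image) , singleton-cong e)
      , (λ (β , β∉c) → let (α , e) = r (β , β∉c ∘ ∈-to-image) in α , singleton-cong e)

    from : singletons (sup A g) ≐ (singletons (sup B f) ∖ singletons c) → sup A g ≐ (sup B f ∖ c)
    from (l , r) =
        (λ α → let ((β , β∉c) , e) = l α in (β , β∉c ∘ ∈-to-image) , singleton-injective e)
      , (λ (β , β∉c) → let (α , e) = r (β , β∉c ∘ ∈-from-image) in α , singleton-injective e)

module _ (h : 𝕍 → 𝕍) (h-atom : ∀ a b c → (a ≐ (b ∖ c)) ⇔ (h a ≐ (h b ∖ h c))) where

  ⟦⟧-invariant : ∀ {n} (φ : Formula n) (ρ σ : Fin n → 𝕍) → (∀ i → σ i ≡ h (ρ i)) →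
    ⟦ φ ⟧ ρ ⇔ ⟦ φ ⟧ σ
  ⟦⟧-invariant (atom i j k) ρ σ σ≡hρ rewrite σ≡hρ i | σ≡hρ j | σ≡hρ k = h-atom (ρ i) (ρ j) (ρ k)
  ⟦⟧-invariant (neg φ) ρ σ σ≡hρ = ¬-cong-⇔ (⟦⟧-invariant φ ρ σ σ≡hρ)
  ⟦⟧-invariant (and φ ψ) ρ σ σ≡hρ = ⟦⟧-invariant φ ρ σ σ≡hρ ×-⇔ ⟦⟧-invariant ψ ρ σ σ≡hρ
  ⟦⟧-invariant (or φ ψ) ρ σ σ≡hρ = ⟦⟧-invariant φ ρ σ σ≡hρ ⊎-⇔ ⟦⟧-invariant ψ ρ σ σ≡hρ
  ⟦⟧-invariant (imp φ ψ) ρ σ σ≡hρ = →-cong-⇔ (⟦⟧-invariant φ ρ σ σ≡hρ) (⟦⟧-invariant ψ ρ σ σ≡hρ)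
  ⟦⟧-invariant (iff φ ψ) ρ σ σ≡hρ = →-cong-⇔ φ⇔ ψ⇔ ×-⇔ →-cong-⇔ ψ⇔ φ⇔
    where
      φ⇔ = ⟦⟧-invariant φ ρ σ σ≡hρ
      ψ⇔ = ⟦⟧-invariant ψ ρ σ σ≡hρ

env-map : ∀ {m} (h : 𝕍 → 𝕍) x y (z : Fin m → 𝕍) i → env (h x) (h y) (h ∘ z) i ≡ h (env x y z i)
env-map h x y z zero = refl
env-map h x y z (suc zero) = refl
env-map h x y z (suc (suc i)) = refl

∅∈singleton∅ : ∅ ∈ singleton ∅
∅∈singleton∅ = tt , ((λ ()) , (λ ()))

singletons-∅∉ : ¬ (singletons ∅ ∈ singletons (singleton ∅))
singletons-∅∉ (_ , ∅≐singleton∅) = proj₁ (proj₂ ∅≐singleton∅ tt)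

theorem1 : ((P : Set₁) → Dec P) →
    (m : ℕ) (Ψ : Formula (suc (suc m))) →
    ¬ ((x y : 𝕍) →
         (x ∈ y → Σ (Fin m → 𝕍) (λ z → ⟦ Ψ ⟧ (env x y z)))
         × (Σ (Fin m → 𝕍) (λ z → ⟦ Ψ ⟧ (env x y z)) → x ∈ y))
theorem1 _ m Ψ defines-∈ = singletons-∅∉ (proj₂ (defines-∈ (h ∅) (h (singleton ∅))) (h ∘ z , Ψ-image))
  where
    h : 𝕍 → 𝕍
    h = singletons

    witnesses : Σ (Fin m → 𝕍) (λ z → ⟦ Ψ ⟧ (env ∅ (singleton ∅) z))
    witnesses = proj₁ (defines-∈ ∅ (singleton ∅)) ∅∈singleton∅

    z : Fin m → 𝕍
    z = proj₁ witnesses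

    Ψ-image : ⟦ Ψ ⟧ (env (h ∅) (h (singleton ∅)) (h ∘ z))
    Ψ-image = Equivalence.to
      (⟦⟧-invariant h singletons-∖ Ψ (env ∅ (singleton ∅) z) _ (env-map h ∅ (singleton ∅) z))
      (proj₂ witnesses)
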